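{- Let $P$ and $Q$ be problems in $\mathrm{NP}$ and $R$ a parsimonious polynomial-time reduction from $P$ to $Q$. For an instance $I_P$ of $P$ let $I_Q = R(I_P)$, where solutions of $I_P$ are represented by certificate strings $x_P \in \Gamma_P^m$ and the solution of $I_Q$ corresponding via $R$ is represented by $x_Q \in \Gamma_Q^n$. Assume that for every $j = 0,\dots,n-1$ either there exist an injective function $f_j:\Gamma_P\to\Gamma_Q$ and a unique index $i$ with $x_Q[j] = f_j(x_P[i])$ for all corresponding solution pairs, or $x_Q[j]$ is constant with respect to $x_P$. Then for every integer $k$: if there exists a clue $c_Q$ of size at most $k$ such that $I_Q$ has a unique solution satisfying $c_Q$, then there exists a clue $c_P$ of size at most $k$ such that $I_P$ has a unique solution satisfying $c_P$.
   Context: For a problem $A$ in $\mathrm{NP}$ with certificates being strings over an alphabet $\Sigma$, a clue is a string $c = (c_i) \in (\Sigma \cup \{\bot\})^*$ such that there is a certificate string $x$ with $c_i = x_i$ whenever $c_i \neq \bot$; we say $x$ satisfies $c$. The size of a clue is the number of positions $i$ with $c_i \neq \bot$. A reduction from $P$ to $Q$ is parsimonious if it comes with a bijective correspondence between solutions of $I_P$ and solutions of $R(I_P)$, so both have the same number of solutions. -}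

module Defs where

open import Data.Nat using (ℕ; zero; suc; _≤_)
open import Data.Bool using (Bool; T)
open import Data.Maybe using (Maybe; just; nothing)
open import Data.Fin using (Fin)
open import Data.Vec using (Vec; []; _∷_; lookup)
open import Data.Sum using (_⊎_)
open import Data.Product using (Σ; ∃; _×_; _,_; proj₁)
open import Relation.Binary.PropositionalEquality using (_≡_)
open import Function.Bundles using (_⤖_; Bijection)
open import Function.Definitions using (Injective)

-- A clue for certificate strings of length m over Γ: ⊥ is 'nothing'.
Clue : Set → ℕ → Set
Clue Γ m = Vec (Maybe Γ) m

Satisfies : {Γ : Set} {m : ℕ} → Clue Γ m → Vec Γ m → Set
Satisfies {m = m} c x = (i : Fin m) → ∀ a → lookup c i ≡ just a → lookup x i ≡ a

IsClue : {Γ : Set} {m : ℕ} → Clue Γ m → Set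
IsClue {Γ} {m} c = Σ (Vec Γ m) (λ x → Satisfies c x)

size : {Γ : Set} {m : ℕ} → Clue Γ m → ℕ
size [] = 0
size (nothing ∷ c) = size c
size (just _ ∷ c) = suc (size c)

Solutions : {Γ : Set} {m : ℕ} → (Vec Γ m → Bool) → Set
Solutions {Γ} {m} V = Σ (Vec Γ m) (λ x → T (V x))

UniqueSolSat : {Γ : Set} {m : ℕ} → (Vec Γ m → Bool) → Clue Γ m → Set
UniqueSolSat {Γ} {m} V c =
  Σ (Vec Γ m) λ x → (T (V x) × Satisfies c x) ×
    ((y : Vec Γ m) → T (V y) → Satisfies c y → y ≡ x)

HasUniqueClue : {Γ : Set} {m : ℕ} → (Vec Γ m → Bool) → ℕ → Set
HasUniqueClue {Γ} {m} V k =
  Σ (Clue Γ m) λ c → IsClue c × size c ≤ k × UniqueSolSat V c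

PositionCondition : {ΓP ΓQ : Set} {m n : ℕ} {VP : Vec ΓP m → Bool} {VQ : Vec ΓQ n → Bool}
  → (Solutions VP ⤖ Solutions VQ) → Fin n → Set
PositionCondition {ΓP} {ΓQ} {m} {n} {VP} {VQ} φ j =
  (Σ (ΓP → ΓQ) λ f → Injective _≡_ _≡_ f ×
     Σ (Fin m) λ i → Holds f i × ((i' : Fin m) → Holds f i' → i' ≡ i))
  ⊎ (Σ ΓQ λ b → (s : Solutions VP) → lookup (proj₁ (Bijection.to φ s)) j ≡ b)
  where
  Holds : (ΓP → ΓQ) → Fin m → Set
  Holds f i = (s : Solutions VP) → lookup (proj₁ (Bijection.to φ s)) j ≡ f (lookup (proj₁ s) i)

-- Reveal, on the side of P, exactly the positions of x_P that the revealed
-- positions of c_Q are copied from. This costs at most one position of c_P per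
-- position of c_Q. If a solution y of I_P satisfies c_P, its image under R agrees
-- with x_Q wherever c_Q is revealed (copied positions agree because y agrees with
-- x_P at their sources, constant positions agree trivially), so by uniqueness the
-- image is x_Q, and y = x_P because R is injective on solutions.
module Submission where

open import Defs
open import Data.Nat using (ℕ; suc; _≤_; s≤s)
open import Data.Nat.Properties using (≤-refl; m≤n⇒m≤1+n; ≤-trans; ≤-reflexive)
open import Data.Bool using (Bool; T)
open import Data.Bool.Properties using (T-irrelevant)
open import Data.Maybe using (Maybe; just; nothing)
open import Data.Maybe.Properties using (just-injective)
import Data.Maybe.Relation.Unary.Any as Maybe
open import Data.Fin using (Fin; zero; suc)
open import Data.Fin.Properties using (_≟_)
open import Data.Vec using (Vec; []; _∷_; lookup; replicate; _[_]≔_)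
open import Data.Vec.Properties using (lookup∘updateAt; lookup∘updateAt′; lookup-replicate)
open import Data.List using (List; []; _∷_; length; map; mapMaybe)
open import Data.List.Properties using (length-map; length-mapMaybe)
open import Data.List.Relation.Unary.Any using (here; there)
import Data.List.Relation.Unary.Any as Any
open import Data.List.Relation.Unary.Any.Properties using (map⁺; mapMaybe⁺)
open import Data.List.Membership.Propositional using (_∈_)
open import Data.List.Membership.Propositional.Properties using (∈-map⁺)
open import Data.Sum using (inj₁; inj₂)
open import Data.Product using (_,_; proj₁; proj₂)
open import Function using (_∘_)
open import Function.Bundles using (_⤖_; Bijection)
open import Relation.Nullary using (yes; no)
open import Relation.Binary.PropositionalEquality

private
  variable
    A B Γ ΓP ΓQ : Set
    m n : ℕ

∈-mapMaybe⁺ : (f : A → Maybe B) {x : A} {y : B} {xs : List A} →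
              x ∈ xs → f x ≡ just y → y ∈ mapMaybe f xs
∈-mapMaybe⁺ f {xs = xs} x∈xs fx≡y =
  mapMaybe⁺ f xs (map⁺ (Any.map (λ { refl → subst (Maybe.Any (_ ≡_)) (sym fx≡y) (Maybe.just refl) }) x∈xs))

revealed : Clue A n → List (Fin n)
revealed []            = []
revealed (nothing ∷ c) = map suc (revealed c)
revealed (just _ ∷ c)  = zero ∷ map suc (revealed c)

length-revealed : (c : Clue A n) → length (revealed c) ≡ size c
length-revealed []            = refl
length-revealed (nothing ∷ c) = trans (length-map suc (revealed c)) (length-revealed c)
length-revealed (just _ ∷ c)  = cong suc (trans (length-map suc (revealed c)) (length-revealed c))

∈-revealed : (c : Clue A n) {j : Fin n} {a : A} → lookup c j ≡ just a → j ∈ revealed c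
∈-revealed (just _ ∷ c)  {zero}  _  = here refl
∈-revealed (nothing ∷ c) {suc j} cj = ∈-map⁺ suc (∈-revealed c cj)
∈-revealed (just _ ∷ c)  {suc j} cj = there (∈-map⁺ suc (∈-revealed c cj))

size-replicate-nothing : (n : ℕ) → size {A} (replicate n nothing) ≡ 0
size-replicate-nothing 0       = refl
size-replicate-nothing (suc n) = size-replicate-nothing n

size-[]≔-just : (c : Clue A n) (i : Fin n) (a : A) → size (c [ i ]≔ just a) ≤ suc (size c)
size-[]≔-just (nothing ∷ c) zero    a = ≤-refl
size-[]≔-just (just _ ∷ c)  zero    a = m≤n⇒m≤1+n ≤-refl
size-[]≔-just (nothing ∷ c) (suc i) a = size-[]≔-just c i a
size-[]≔-just (just _ ∷ c)  (suc i) a = s≤s (size-[]≔-just c i a)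

reveal : Vec A m → List (Fin m) → Clue A m
reveal x []      = replicate _ nothing
reveal x (i ∷ L) = reveal x L [ i ]≔ just (lookup x i)

size-reveal : (x : Vec A m) (L : List (Fin m)) → size (reveal x L) ≤ length L
size-reveal {m = m} x [] = ≤-reflexive (size-replicate-nothing m)
size-reveal x (i ∷ L) = ≤-trans (size-[]≔-just (reveal x L) i (lookup x i)) (s≤s (size-reveal x L))

reveal-satisfied : (x : Vec A m) (L : List (Fin m)) → Satisfies (reveal x L) x
reveal-satisfied x [] i a eq with () ← trans (sym (lookup-replicate i nothing)) eq
reveal-satisfied x (j ∷ L) i a eq with j ≟ i
... | yes refl = just-injective (trans (sym (lookup∘updateAt i (reveal x L))) eq)
... | no j≢i   = reveal-satisfied x L i a (trans (sym (lookup∘updateAt′ i j (j≢i ∘ sym) (reveal x L))) eq)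

lookup-reveal-∈ : (x : Vec A m) {L : List (Fin m)} {i : Fin m} →
                  i ∈ L → lookup (reveal x L) i ≡ just (lookup x i)
lookup-reveal-∈ x {i ∷ L} (here refl) = lookup∘updateAt i (reveal x L)
lookup-reveal-∈ x {j ∷ L} {i} (there i∈L) with j ≟ i
... | yes refl = lookup∘updateAt i (reveal x L)
... | no j≢i   = trans (lookup∘updateAt′ i j (j≢i ∘ sym) (reveal x L)) (lookup-reveal-∈ x i∈L)

solution-≡ : {V : Vec Γ m → Bool} {s t : Solutions V} → proj₁ s ≡ proj₁ t → s ≡ t
solution-≡ {s = x , p} {t = .x , q} refl = cong (x ,_) (T-irrelevant p q)

module _ {VP : Vec ΓP m → Bool} {VQ : Vec ΓQ n → Bool} (φ : Solutions VP ⤖ Solutions VQ) where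
  open Bijection φ using (to)

  sourceIndex : {j : Fin n} → PositionCondition φ j → Maybe (Fin m)
  sourceIndex (inj₁ (_ , _ , i , _)) = just i
  sourceIndex (inj₂ _)               = nothing

  -- Neither the injectivity of f_j nor the uniqueness of its source index is needed.
  lookup-to-determined : {j : Fin n} (pc : PositionCondition φ j) (s t : Solutions VP) →
                         (∀ {i} → sourceIndex pc ≡ just i → lookup (proj₁ s) i ≡ lookup (proj₁ t) i) →
                         lookup (proj₁ (to s)) j ≡ lookup (proj₁ (to t)) j
  lookup-to-determined (inj₁ (f , _ , i , copies , _)) s t agree =
    trans (copies s) (trans (cong f (agree refl)) (sym (copies t)))
  lookup-to-determined (inj₂ (_ , constant)) s t _ = trans (constant s) (sym (constant t))

  module _ (pc : (j : Fin n) → PositionCondition φ j) where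

    sources : Clue ΓQ n → List (Fin m)
    sources c = mapMaybe (sourceIndex ∘ pc) (revealed c)

    length-sources : (c : Clue ΓQ n) → length (sources c) ≤ size c
    length-sources c = ≤-trans (length-mapMaybe (sourceIndex ∘ pc) (revealed c)) (≤-reflexive (length-revealed c))

    to-satisfies : (c : Clue ΓQ n) (s t : Solutions VP) →
                   (∀ {i} → i ∈ sources c → lookup (proj₁ s) i ≡ lookup (proj₁ t) i) →
                   Satisfies c (proj₁ (to t)) → Satisfies c (proj₁ (to s))
    to-satisfies c s t agree t⊨c j b cj≡b =
      trans (lookup-to-determined (pc j) s t (agree ∘ ∈-mapMaybe⁺ (sourceIndex ∘ pc) (∈-revealed c cj≡b)))
            (t⊨c j b cj≡b)

lemma2 : {ΓP ΓQ : Set} {m n : ℕ}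
    → (VP : Vec ΓP m → Bool) (VQ : Vec ΓQ n → Bool)
    → (φ : Solutions VP ⤖ Solutions VQ)
    → ((j : Fin n) → PositionCondition φ j)
    → (k : ℕ) → HasUniqueClue VQ k → HasUniqueClue VP k
lemma2 VP VQ φ pc k (cQ , _ , size≤k , xQ , (xQ-sol , xQ⊨cQ) , unique) =
  cP , (xP , xP⊨cP) , size≤k′ , xP , (proj₂ sP , xP⊨cP) , uniqueP
  where
  open Bijection φ using (to; injective; strictlySurjective)

  sP : Solutions VP
  sP = proj₁ (strictlySurjective (xQ , xQ-sol))

  to-sP : to sP ≡ (xQ , xQ-sol)
  to-sP = proj₂ (strictlySurjective (xQ , xQ-sol))

  xP : Vec _ _
  xP = proj₁ sP

  L : List (Fin _)
  L = sources φ pc cQ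

  cP : Clue _ _
  cP = reveal xP L

  xP⊨cP : Satisfies cP xP
  xP⊨cP = reveal-satisfied xP L

  size≤k′ : size cP ≤ k
  size≤k′ = ≤-trans (size-reveal xP L) (≤-trans (length-sources φ pc cQ) size≤k)

  uniqueP : (y : Vec _ _) → T (VP y) → Satisfies cP y → y ≡ xP
  uniqueP y y-sol y⊨cP = cong proj₁ (injective (solution-≡ same-image))
    where
    image⊨cQ : Satisfies cQ (proj₁ (to (y , y-sol)))
    image⊨cQ = to-satisfies φ pc cQ (y , y-sol) sP (λ i∈L → y⊨cP _ _ (lookup-reveal-∈ xP i∈L))
                            (subst (Satisfies cQ ∘ proj₁) (sym to-sP) xQ⊨cQ)

    same-image : proj₁ (to (y , y-sol)) ≡ proj₁ (to sP)
    same-image = trans (unique _ (proj₂ (to (y , y-sol))) image⊨cQ) (cong proj₁ (sym to-sP))
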